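{- Let $a,b$ be integers with $b\ge3$, $1\le a<\frac b2$ and $\gcd(a,b)=1$. Then $(1,1)\notin\mathcal S_{a,b}$, and $(h,2)\notin\mathcal S_{a,b}$ for every positive integer $h$. Moreover, for every positive integer $h$ with $\gcd(h,3)=1$, we have $(h,3)\in\mathcal S_{a,b}$ if and only if $(a,b)=(1,3)$.
   Context: $\mathcal S_{a,b}$ is the set of pairs $(h,k)$ of positive integers for which there exists an integer $j_0\in[1,k]$ with $ak+j_0bh\equiv0\pmod{bk}$. -}

module Defs where

open import Data.Nat using (ℕ; _+_; _*_; _≤_; _<_)
open import Data.Nat.Divisibility using (_∣_)
open import Data.Product using (Σ; _×_)

-- (h , k) ∈ S_{a,b}  :  h, k positive and ∃ j₀ ∈ [1, k] with
-- a k + j₀ b h ≡ 0 (mod b k), i.e. b k ∣ a k + j₀ b h.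
-- (All quantities are nonnegative naturals here since a ≥ 1, b ≥ 3.)
InS : ℕ → ℕ → ℕ → ℕ → Set
InS a b h k =
  (1 ≤ h) × (1 ≤ k) ×
  Σ ℕ (λ j₀ → (1 ≤ j₀) × (j₀ ≤ k) × (b * k ∣ a * k + j₀ * b * h))

module Submission where

open import Defs
open import Data.Nat using (ℕ; zero; suc; _+_; _*_; _≤_; _<_; _%_; _/_; z≤n; s≤s; >-nonZero)
open import Data.Nat.Properties
open import Data.Nat.Divisibility
open import Data.Nat.DivMod using (m%n<n; m≡m%n+[m/n]*n)
open import Data.Nat.GCD using (gcd)
open import Data.Nat.Coprimality using (gcd≡1⇒coprime)
open import Data.Nat.Tactic.RingSolver using (solve-∀)
open import Data.Product using (Σ; _×_; _,_)
open import Function.Bundles using (_⇔_; mk⇔)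
open import Relation.Binary.PropositionalEquality using (_≡_; refl; sym; trans; cong; subst)
open import Relation.Nullary using (¬_; contradiction)

-- Reducing the defining congruence a k + j b h ≡ 0 (mod b k) modulo b kills the j-term,
-- so membership only depends on b ∣ a k, which is impossible for a k < b and forces
-- a k = b when b ≤ a k < 2 b; for k = 3 this means b = 3 a, and coprimality gives a = 1.
-- Conversely for (a , b) = (1 , 3) the congruence reads 3 ∣ 1 + j h, solvable when 3 ∤ h.

∣ak+jbh⇒∣ak : ∀ a b h k j → b * k ∣ a * k + j * b * h → b ∣ a * k
∣ak+jbh⇒∣ak a b h k j bk∣ =
  ∣m+n∣m⇒∣n (subst (b ∣_) (+-comm (a * k) (j * b * h)) (m*n∣⇒m∣ b k bk∣)) (n∣m*n*o j h)

InS⇒∣ak : ∀ {a b h k} → InS a b h k → b ∣ a * k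
InS⇒∣ak {a} {b} {h} {k} (_ , _ , j , _ , _ , bk∣) = ∣ak+jbh⇒∣ak a b h k j bk∣

m∣n∧0<n<2m⇒n≡m : ∀ {m n} → m ∣ n → 0 < n → n < 2 * m → n ≡ m
m∣n∧0<n<2m⇒n≡m (divides zero refl) () _
m∣n∧0<n<2m⇒n≡m {m} (divides (suc zero) refl) _ _ = +-identityʳ m
m∣n∧0<n<2m⇒n≡m {m} (divides (suc (suc q)) refl) _ n<2m =
  contradiction (+-monoʳ-≤ m (+-monoʳ-≤ m z≤n)) (<⇒≱ n<2m)

2m<n⇒3m<2n : ∀ {m n} → 2 * m < n → 3 * m < 2 * n
2m<n⇒3m<2n {m} {n} 2m<n =
  ≤-<-trans (*-monoˡ-≤ m {3} {4} (s≤s (s≤s (s≤s z≤n))))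
            (subst (_< 2 * n) (sym (*-assoc 2 2 m)) (*-monoʳ-< 2 2m<n))

¬InS-ak<b : ∀ {a b h k} → 1 ≤ a → a * k < b → ¬ InS a b h k
¬InS-ak<b {a} {b} {h} {k} a≥1 ak<b s@(_ , k≥1 , _) =
  >⇒∤ ⦃ >-nonZero (*-mono-≤ {1} {a} {1} {k} a≥1 k≥1) ⦄ ak<b (InS⇒∣ak {a} s)

InS-k≡3⇒ak≡b : ∀ {a b h} → 1 ≤ a → 2 * a < b → InS a b h 3 → a * 3 ≡ b
InS-k≡3⇒ak≡b {a} {b} a≥1 2a<b s =
  m∣n∧0<n<2m⇒n≡m (InS⇒∣ak {a} s) (*-mono-≤ {1} {a} {1} {3} a≥1 (s≤s z≤n))
    (subst (_< 2 * b) (*-comm 3 a) (2m<n⇒3m<2n {a} 2a<b))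

3∤h⇒∃j[3∣1+jh] : ∀ {h} → ¬ 3 ∣ h → Σ ℕ λ j → 1 ≤ j × j ≤ 2 × 3 ∣ 1 + j * h
3∤h⇒∃j[3∣1+jh] {h} 3∤h with h % 3 | m%n<n h 3 | m≡m%n+[m/n]*n h 3
... | 0 | _ | h≡ = contradiction (divides (h / 3) h≡) 3∤h
... | 1 | _ | h≡ = 2 , s≤s z≤n , ≤-refl ,
  divides (1 + 2 * (h / 3)) (trans (cong (λ x → 1 + 2 * x) h≡) (factor (h / 3)))
  where
  factor : ∀ q → 1 + 2 * (1 + q * 3) ≡ (1 + 2 * q) * 3
  factor = solve-∀
... | 2 | _ | h≡ = 1 , ≤-refl , s≤s z≤n ,
  divides (1 + h / 3) (trans (cong (λ x → 1 + 1 * x) h≡) (factor (h / 3)))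
  where
  factor : ∀ q → 1 + 1 * (2 + q * 3) ≡ (1 + q) * 3
  factor = solve-∀
... | suc (suc (suc _)) | s≤s (s≤s (s≤s ())) | _

InS[1,3,h,3] : ∀ {h} → 1 ≤ h → ¬ 3 ∣ h → InS 1 3 h 3
InS[1,3,h,3] {h} h≥1 3∤h with 3∤h⇒∃j[3∣1+jh] 3∤h
... | j , j≥1 , j≤2 , 3∣1+jh =
  h≥1 , s≤s z≤n , j , j≥1 , m≤n⇒m≤1+n j≤2 ,
  subst (9 ∣_) (expand j h) (*-monoʳ-∣ 3 3∣1+jh)
  where
  expand : ∀ j h → 3 * (1 + j * h) ≡ 3 + j * 3 * h
  expand = solve-∀

lemma5p4 : (a b : ℕ) → 3 ≤ b → 1 ≤ a → 2 * a < b → gcd a b ≡ 1 →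
    (¬ InS a b 1 1)
    × ((h : ℕ) → 1 ≤ h → ¬ InS a b h 2)
    × ((h : ℕ) → 1 ≤ h → gcd h 3 ≡ 1 → (InS a b h 3 ⇔ ((a ≡ 1) × (b ≡ 3))))
lemma5p4 a b _ a≥1 2a<b gcd[a,b]≡1 =
  ¬InS-ak<b a≥1 a*1<b , (λ _ _ → ¬InS-ak<b a≥1 a*2<b) , k≡3
  where
  a*2<b : a * 2 < b
  a*2<b = subst (_< b) (*-comm 2 a) 2a<b
  a*1<b : a * 1 < b
  a*1<b = ≤-<-trans (*-monoʳ-≤ a {1} {2} (s≤s z≤n)) a*2<b
  only-1-3 : ∀ {h} → InS a b h 3 → (a ≡ 1) × (b ≡ 3)
  only-1-3 s = a≡1 , trans (sym a*3≡b) (cong (_* 3) a≡1)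
    where
    a*3≡b : a * 3 ≡ b
    a*3≡b = InS-k≡3⇒ak≡b a≥1 2a<b s
    a≡1 : a ≡ 1
    a≡1 = gcd≡1⇒coprime gcd[a,b]≡1 (∣-refl , subst (a ∣_) a*3≡b (m∣m*n 3))
  k≡3 : (h : ℕ) → 1 ≤ h → gcd h 3 ≡ 1 → (InS a b h 3 ⇔ ((a ≡ 1) × (b ≡ 3)))
  k≡3 h h≥1 gcd[h,3]≡1 = mk⇔ only-1-3 λ { (refl , refl) → InS[1,3,h,3] h≥1 3∤h }
    where
    3∤h : ¬ 3 ∣ h
    3∤h 3∣h with () ← gcd≡1⇒coprime gcd[h,3]≡1 (3∣h , ∣-refl)
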